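{- Let $\mathbf A$ be an $\mathcal I$-zroupoid satisfying $x'' \approx x$ and $(x \to y)' \approx x \to (0 \to y)$. Then $\mathbf A$ satisfies $x \to y' \approx x \to (0 \to y)$.
   Context: An $\mathcal I$-zroupoid is an algebra $\langle A,\to,0\rangle$ ($\to$ binary, $0$ constant) satisfying $(x \to y) \to z \approx [(z' \to x) \to (y \to z)']'$ and $0''\approx 0$, where $x' := x \to 0$ (prime binds tighter than $\to$). -}

module Defs where

open import Level using (Level; suc)
open import Relation.Binary.PropositionalEquality using (_≡_)

record IZroupoid (a : Level) : Set (suc a) where
  infixr 5 _⇒_
  field
    Carrier : Set a
    _⇒_     : Carrier → Carrier → Carrier
    𝟎       : Carrier

  infix 8 _′
  _′ : Carrier → Carrier
  x ′ = x ⇒ 𝟎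

  field
    I-ax : ∀ x y z → (x ⇒ y) ⇒ z ≡ (((z ′) ⇒ x) ⇒ ((y ⇒ z) ′)) ′
    0''  : (𝟎 ′) ′ ≡ 𝟎

-- Under x ′ ′ ≈ x the axiom at (x , 0 , 0) makes 0 ′ a left identity, so
-- y ′ ≈ (0 ′ ⇒ y) ′ ≈ 0 ′ ⇒ (0 ⇒ y) ≈ 0 ⇒ y by the second hypothesis.
module Submission where

open import Defs
open import Level using (Level)
open import Relation.Binary.PropositionalEquality using (_≡_; sym; cong; module ≡-Reasoning)

module _ {a : Level} (A : IZroupoid a) where
  open IZroupoid A
  open ≡-Reasoning

  Involutive′ : Set a
  Involutive′ = ∀ x → (x ′) ′ ≡ x

  ′′≡[0′⇒]′′ : ∀ x → (x ′) ′ ≡ ((𝟎 ′ ⇒ x) ′) ′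
  ′′≡[0′⇒]′′ x = begin
    (x ′) ′                              ≡⟨ I-ax x 𝟎 𝟎 ⟩
    ((𝟎 ′ ⇒ x) ⇒ (𝟎 ′) ′) ′              ≡⟨ cong (λ u → ((𝟎 ′ ⇒ x) ⇒ u) ′) 0'' ⟩
    ((𝟎 ′ ⇒ x) ′) ′                      ∎

  0′⇒-identityˡ : Involutive′ → ∀ x → 𝟎 ′ ⇒ x ≡ x
  0′⇒-identityˡ inv x = begin
    𝟎 ′ ⇒ x                              ≡⟨ sym (inv (𝟎 ′ ⇒ x)) ⟩
    ((𝟎 ′ ⇒ x) ′) ′                      ≡⟨ sym (′′≡[0′⇒]′′ x) ⟩
    (x ′) ′                              ≡⟨ inv x ⟩
    x                                    ∎

lemma3p2 : ∀ {a : Level} (A : IZroupoid a) → let open IZroupoid A in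
    (∀ x → (x ′) ′ ≡ x) →
    (∀ x y → (x ⇒ y) ′ ≡ x ⇒ (𝟎 ⇒ y)) →
    ∀ x y → x ⇒ (y ′) ≡ x ⇒ (𝟎 ⇒ y)
lemma3p2 A inv ′-distrib x y = cong (x ⇒_) y′≡0⇒y
  where
  open IZroupoid A
  open ≡-Reasoning
  y′≡0⇒y : y ′ ≡ 𝟎 ⇒ y
  y′≡0⇒y = begin
    y ′                                  ≡⟨ cong _′ (sym (0′⇒-identityˡ A inv y)) ⟩
    (𝟎 ′ ⇒ y) ′                          ≡⟨ ′-distrib (𝟎 ′) y ⟩
    𝟎 ′ ⇒ (𝟎 ⇒ y)                        ≡⟨ 0′⇒-identityˡ A inv (𝟎 ⇒ y) ⟩
    𝟎 ⇒ y                                ∎
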